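{- For each integer $r\ge0$ let $P_r$ be the unique polynomial with $S_{2r+1}(n)=P_r(n)\,n\binom{2n}{n}$ for all positive integers $n$, and let $Q_r$ be the unique polynomial with $S_{2r}(n)=Q_r(n)\,2^{2n-r}$ for all positive integers $n$ (such polynomials exist). Then the leading coefficient of $P_r$ is $r!$ and the leading coefficient of $Q_r$ is $(2r-1)(2r-3)\cdots 3\cdot 1=\frac{(2r)!}{2^r r!}$.
   Context: For integers $m\ge 0$ and $n\ge 0$, $S_m(n)=\sum_{k=0}^{2n}\binom{2n}{k}|n-k|^m$, with the convention $0^0=1$. Polynomials are in one variable with rational (in fact integer) coefficients; the polynomials $P_r,Q_r$ have degree $r$. -}

module Defs where

open import Data.Nat as ℕ using (ℕ; zero; suc; ∣_-_∣; _!)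
open import Data.Nat.Combinatorics using (_C_)
open import Data.Integer as ℤ using (ℤ; +_; -[1+_])
open import Data.Rational as ℚ using (ℚ; _/_; ½; 0ℚ; 1ℚ)
open import Data.List using (List; []; _∷_; map; upTo)
open import Data.Nat.ListAction using (sum)
open import Relation.Nullary using (yes; no)

-- S_m(n) = Σ_{k=0}^{2n} C(2n,k) |n-k|^m   (Agda's 0 ^ 0 = 1)
S : ℕ → ℕ → ℕ
S m n = sum (map (λ k → ((2 ℕ.* n) C k) ℕ.* (∣ n - k ∣ ℕ.^ m)) (upTo (suc (2 ℕ.* n))))

ℕtoℚ : ℕ → ℚ
ℕtoℚ k = + k / 1

powℚ : ℚ → ℕ → ℚ
powℚ q zero = 1ℚ
powℚ q (suc k) = q ℚ.* powℚ q k

twoPow : ℤ → ℚ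
twoPow (+ k) = powℚ (ℕtoℚ 2) k
twoPow -[1+ k ] = powℚ ½ (suc k)

-- polynomials with rational coefficients: coefficient lists, constant term first
Poly : Set
Poly = List ℚ

eval : Poly → ℚ → ℚ
eval [] x = 0ℚ
eval (a ∷ as) x = a ℚ.+ x ℚ.* eval as x

-- leading coefficient: the last nonzero coefficient (0 for the zero polynomial)
lead : Poly → ℚ
lead [] = 0ℚ
lead (a ∷ as) with lead as ℚ.≟ 0ℚ
... | yes _ = a
... | no _ = lead as

oddProd : ℕ → ℕ
oddProd zero = 1
oddProd (suc r) = (2 ℕ.* r ℕ.+ 1) ℕ.* oddProd r

IsP : ℕ → Poly → Set
IsP r P = ∀ (n : ℕ) → 1 ℕ.≤ n →
  ℕtoℚ (S (2 ℕ.* r ℕ.+ 1) n) ≡ eval P (ℕtoℚ n) ℚ.* ℕtoℚ (n ℕ.* ((2 ℕ.* n) C n))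
  where open import Relation.Binary.PropositionalEquality using (_≡_)

IsQ : ℕ → Poly → Set
IsQ r Q = ∀ (n : ℕ) → 1 ℕ.≤ n →
  ℕtoℚ (S (2 ℕ.* r) n) ≡ eval Q (ℕtoℚ n) ℚ.* twoPow (+ (2 ℕ.* n) ℤ.- + r)
  where open import Relation.Binary.PropositionalEquality using (_≡_)

module Submission where

open import Defs
open import Data.Nat using (ℕ; _!)
open import Data.Product using (_×_; ∃)
open import Relation.Binary.PropositionalEquality using (_≡_)

open import Data.Nat as ℕ using (zero; suc; z≤n; s≤s; ∣_-_∣; NonZero)
import Data.Nat.Properties as ℕP
open import Data.Nat.Combinatorics using (_C_; nC1≡n; nCk+nC[k+1]≡[n+1]C[k+1]; k>n⇒nCk≡0)
open import Data.Nat.ListAction using (sum)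
open import Data.List using ([]; _∷_; length; map; applyUpTo)
open import Data.List.Relation.Unary.All using (All; []; _∷_)
open import Data.Product using (_,_; proj₁; proj₂)
open import Data.Sum using (inj₁; inj₂)
open import Data.Empty using (⊥-elim)
open import Relation.Nullary using (yes; no)
open import Relation.Binary.PropositionalEquality
  using (_≢_; refl; sym; trans; cong; cong₂; subst; module ≡-Reasoning)

-- The sums satisfy S_{m+2}(n+1) = (n+1)² S_m(n+1) − (2n+2)(2n+1) S_m(n), summand by summand, because
-- C(2n+2,j+1)(n−j)² + (2n+2)(2n+1) C(2n,j) = (n+1)² C(2n+2,j+1). With S_1(n) = n C(2n,n), S_0(n) = 4ⁿ and
-- (n+1)² C(2n+2,n+1) = (2n+2)(2n+1) C(2n,n) this yields P_0 = Q_0 = 1 and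
--   P_{r+1}(x) = x (x P_r(x) − (x−1) P_r(x−1)),   Q_{r+1}(x) = x (2x Q_r(x) − (2x−1) Q_r(x−1)).
-- Written with the backward difference ∇, which multiplies the top coefficient by the degree, these steps
-- multiply the top coefficient by r+1 and by (r+1)+r = 2r+1 respectively. Leading coefficients are unique
-- because a polynomial vanishing at all positive integers is zero.

-- Binomial sums

module _ where
  open import Data.Nat using (_+_; _*_; _^_; _≤_; _<_)
  open import Data.Nat.Properties
  open import Data.Nat.Solver using (module +-*-Solver)
  open +-*-Solver
  open ≡-Reasoning
  open import Algebra.Properties.CommutativeSemigroup +-commutativeSemigroup
    using (interchange; x∙yz≈y∙xz; xy∙z≈y∙xz)
  open import Algebra.Properties.CommutativeSemigroup *-commutativeSemigroup
    using () renaming (x∙yz≈y∙xz to x*yz≡y*xz)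

  sumBelow : ℕ → (ℕ → ℕ) → ℕ
  sumBelow zero    f = 0
  sumBelow (suc N) f = f 0 + sumBelow N (λ k → f (suc k))

  sum-map-applyUpTo : ∀ N (f g : ℕ → ℕ) → sum (map f (applyUpTo g N)) ≡ sumBelow N (λ k → f (g k))
  sum-map-applyUpTo zero    f g = refl
  sum-map-applyUpTo (suc N) f g = cong (f (g 0) +_) (sum-map-applyUpTo N f (λ k → g (suc k)))

  sumBelow-cong : ∀ N {f g : ℕ → ℕ} → (∀ k → k < N → f k ≡ g k) → sumBelow N f ≡ sumBelow N g
  sumBelow-cong zero    eq = refl
  sumBelow-cong (suc N) eq = cong₂ _+_ (eq 0 (s≤s z≤n)) (sumBelow-cong N (λ k k<N → eq (suc k) (s≤s k<N)))

  sumBelow-+ : ∀ N (f g : ℕ → ℕ) → sumBelow N (λ k → f k + g k) ≡ sumBelow N f + sumBelow N g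
  sumBelow-+ zero    f g = refl
  sumBelow-+ (suc N) f g =
    trans (cong ((f 0 + g 0) +_) (sumBelow-+ N (λ k → f (suc k)) (λ k → g (suc k))))
          (interchange (f 0) (g 0) _ _)

  sumBelow-*ˡ : ∀ N c (f : ℕ → ℕ) → sumBelow N (λ k → c * f k) ≡ c * sumBelow N f
  sumBelow-*ˡ zero    c f = sym (*-zeroʳ c)
  sumBelow-*ˡ (suc N) c f =
    trans (cong (c * f 0 +_) (sumBelow-*ˡ N c (λ k → f (suc k)))) (sym (*-distribˡ-+ c _ _))

  sumBelow-suc : ∀ N (f : ℕ → ℕ) → sumBelow (suc N) f ≡ sumBelow N f + f N
  sumBelow-suc zero    f = +-comm (f 0) 0
  sumBelow-suc (suc N) f =
    trans (cong (f 0 +_) (sumBelow-suc N (λ k → f (suc k)))) (sym (+-assoc (f 0) _ _))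

  sumBelow-+-range : ∀ a b (f : ℕ → ℕ) → sumBelow (a + b) f ≡ sumBelow a f + sumBelow b (λ k → f (a + k))
  sumBelow-+-range zero    b f = refl
  sumBelow-+-range (suc a) b f =
    trans (cong (f 0 +_) (sumBelow-+-range a b (λ k → f (suc k)))) (sym (+-assoc (f 0) _ _))

  telescope-up : ∀ N (f h : ℕ → ℕ) → (∀ k → k < N → f k + h k ≡ h (suc k)) →
                 sumBelow N f + h 0 ≡ h N
  telescope-up zero    f h step = refl
  telescope-up (suc N) f h step = begin
    (f 0 + sumBelow N (λ k → f (suc k))) + h 0  ≡⟨ xy∙z≈y∙xz (f 0) _ (h 0) ⟩
    sumBelow N (λ k → f (suc k)) + (f 0 + h 0)  ≡⟨ cong (sumBelow N (λ k → f (suc k)) +_) (step 0 (s≤s z≤n)) ⟩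
    sumBelow N (λ k → f (suc k)) + h 1          ≡⟨ telescope-up N (λ k → f (suc k)) (λ k → h (suc k))
                                                      (λ k k<N → step (suc k) (s≤s k<N)) ⟩
    h (suc N) ∎

  telescope-down : ∀ N (f h : ℕ → ℕ) → (∀ k → k < N → f k + h (suc k) ≡ h k) →
                   sumBelow N f + h N ≡ h 0
  telescope-down zero    f h step = refl
  telescope-down (suc N) f h step = begin
    (f 0 + sumBelow N (λ k → f (suc k))) + h (suc N)  ≡⟨ +-assoc (f 0) _ (h (suc N)) ⟩
    f 0 + (sumBelow N (λ k → f (suc k)) + h (suc N))  ≡⟨ cong (f 0 +_) (telescope-down N (λ k → f (suc k)) (λ k → h (suc k))
                                                            (λ k k<N → step (suc k) (s≤s k<N))) ⟩
    f 0 + h 1                                         ≡⟨ step 0 (s≤s z≤n) ⟩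
    h 0 ∎

  S≡sumBelow : ∀ m n → S m n ≡ sumBelow (suc (2 * n)) (λ k → ((2 * n) C k) * ∣ n - k ∣ ^ m)
  S≡sumBelow m n = sum-map-applyUpTo (suc (2 * n)) (λ k → ((2 * n) C k) * ∣ n - k ∣ ^ m) (λ k → k)

  [k+1]*[n+1]C[k+1]≡[n+1]*nCk : ∀ n k → suc k * (suc n C suc k) ≡ suc n * (n C k)
  [k+1]*[n+1]C[k+1]≡[n+1]*nCk n       zero    =
    trans (*-identityˡ (suc n C 1)) (trans (nC1≡n (suc n)) (sym (*-identityʳ (suc n))))
  [k+1]*[n+1]C[k+1]≡[n+1]*nCk zero    (suc k) = *-zeroʳ (suc (suc k))
  [k+1]*[n+1]C[k+1]≡[n+1]*nCk (suc n) (suc k) = begin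
    suc (suc k) * (suc (suc n) C suc (suc k))
      ≡⟨ cong (suc (suc k) *_) (sym (nCk+nC[k+1]≡[n+1]C[k+1] (suc n) (suc k))) ⟩
    suc (suc k) * (X + Y)
      ≡⟨ solve 3 (λ k X Y → (con 2 :+ k) :* (X :+ Y) := X :+ ((con 1 :+ k) :* X :+ (con 2 :+ k) :* Y)) refl k X Y ⟩
    X + (suc k * X + suc (suc k) * Y)
      ≡⟨ cong₂ (λ u v → X + (u + v)) ([k+1]*[n+1]C[k+1]≡[n+1]*nCk n k) ([k+1]*[n+1]C[k+1]≡[n+1]*nCk n (suc k)) ⟩
    X + (suc n * A + suc n * B)
      ≡⟨ cong (_+ (suc n * A + suc n * B)) (sym (nCk+nC[k+1]≡[n+1]C[k+1] n k)) ⟩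
    (A + B) + (suc n * A + suc n * B)
      ≡⟨ solve 3 (λ n A B → (A :+ B) :+ ((con 1 :+ n) :* A :+ (con 1 :+ n) :* B) := (con 2 :+ n) :* (A :+ B)) refl n A B ⟩
    suc (suc n) * (A + B)
      ≡⟨ cong (suc (suc n) *_) (nCk+nC[k+1]≡[n+1]C[k+1] n k) ⟩
    suc (suc n) * (suc n C suc k) ∎
    where
    X = suc n C suc k
    Y = suc n C suc (suc k)
    A = n C k
    B = n C suc k

  l*[n+1]Ck≡[n+1]*nCk : ∀ n k l → k + l ≡ suc n → l * (suc n C k) ≡ suc n * (n C k)
  l*[n+1]Ck≡[n+1]*nCk n zero    l k+l≡n+1 = cong (_* 1) k+l≡n+1
  l*[n+1]Ck≡[n+1]*nCk n (suc k) l k+l≡n+1 = +-cancelˡ-≡ (suc k * X) _ _ (begin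
    suc k * X + l * X              ≡⟨ sym (*-distribʳ-+ X (suc k) l) ⟩
    (suc k + l) * X                ≡⟨ cong (_* X) k+l≡n+1 ⟩
    suc n * X                      ≡⟨ cong (suc n *_) (sym (nCk+nC[k+1]≡[n+1]C[k+1] n k)) ⟩
    suc n * (n C k + n C suc k)    ≡⟨ *-distribˡ-+ (suc n) (n C k) (n C suc k) ⟩
    suc n * (n C k) + suc n * (n C suc k)
                                   ≡⟨ cong (_+ suc n * (n C suc k)) (sym ([k+1]*[n+1]C[k+1]≡[n+1]*nCk n k)) ⟩
    suc k * X + suc n * (n C suc k) ∎)
    where X = suc n C suc k

  [k+1]*nC[k+1]≡l*nCk : ∀ n k l → k + l ≡ n → suc k * (n C suc k) ≡ l * (n C k)
  [k+1]*nC[k+1]≡l*nCk zero    zero zero refl = refl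
  [k+1]*nC[k+1]≡l*nCk (suc n) k    l    k+l≡n =
    trans ([k+1]*[n+1]C[k+1]≡[n+1]*nCk n k) (sym (l*[n+1]Ck≡[n+1]*nCk n k l k+l≡n))

  nCk>0 : ∀ n k → k ≤ n → 0 < n C k
  nCk>0 n       zero    _         = s≤s z≤n
  nCk>0 (suc n) (suc k) (s≤s k≤n) =
    subst (0 <_) (nCk+nC[k+1]≡[n+1]C[k+1] n k) (<-≤-trans (nCk>0 n k k≤n) (m≤m+n (n C k) (n C suc k)))

  binomialRowSum : ∀ N → sumBelow (suc N) (N C_) ≡ 2 ^ N
  binomialRowSum zero    = refl
  binomialRowSum (suc N) = begin
    1 + sumBelow (suc N) (λ k → suc N C suc k)
      ≡⟨ cong (1 +_) (sumBelow-cong (suc N) (λ k _ → sym (nCk+nC[k+1]≡[n+1]C[k+1] N k))) ⟩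
    1 + sumBelow (suc N) (λ k → N C k + N C suc k)
      ≡⟨ cong (1 +_) (sumBelow-+ (suc N) (N C_) (λ k → N C suc k)) ⟩
    1 + (sumBelow (suc N) (N C_) + T)
      ≡⟨ cong (λ x → 1 + (x + T)) (binomialRowSum N) ⟩
    1 + (2 ^ N + T)
      ≡⟨ x∙yz≈y∙xz 1 (2 ^ N) T ⟩
    2 ^ N + (1 + T)
      ≡⟨ cong (2 ^ N +_) (sumBelow-suc (suc N) (N C_)) ⟩
    2 ^ N + (sumBelow (suc N) (N C_) + N C suc N)
      ≡⟨ cong₂ (λ x y → 2 ^ N + (x + y)) (binomialRowSum N) (k>n⇒nCk≡0 (n<1+n N)) ⟩
    2 ^ N + (2 ^ N + 0) ∎
    where T = sumBelow (suc N) (λ k → N C suc k)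

  S[0,n]≡2^[2n] : ∀ n → S 0 n ≡ 2 ^ (2 * n)
  S[0,n]≡2^[2n] n = begin
    S 0 n                                               ≡⟨ S≡sumBelow 0 n ⟩
    sumBelow (suc (2 * n)) (λ k → ((2 * n) C k) * 1)   ≡⟨ sumBelow-cong (suc (2 * n)) (λ k _ → *-identityʳ ((2 * n) C k)) ⟩
    sumBelow (suc (2 * n)) ((2 * n) C_)                 ≡⟨ binomialRowSum (2 * n) ⟩
    2 ^ (2 * n) ∎

  ∣m+n-m∣≡n : ∀ m n → ∣ m + n - m ∣ ≡ n
  ∣m+n-m∣≡n m n = trans (∣-∣-comm (m + n) m) (∣m-m+n∣≡n m n)

  S₁-lower-step : ∀ n k d → k + d ≡ n →
    2 * (((2 * n) C k) * ∣ n - k ∣ ^ 1) + k * ((2 * n) C k) ≡ suc k * ((2 * n) C suc k)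
  S₁-lower-step .(k + d) k d refl = begin
    2 * (X * ∣ k + d - k ∣ ^ 1) + k * X
      ≡⟨ cong (λ x → 2 * (X * x) + k * X) (trans (*-identityʳ _) (∣m+n-m∣≡n k d)) ⟩
    2 * (X * d) + k * X
      ≡⟨ solve 3 (λ X d k → con 2 :* (X :* d) :+ k :* X := (d :+ (k :+ d)) :* X) refl X d k ⟩
    (d + (k + d)) * X
      ≡⟨ sym ([k+1]*nC[k+1]≡l*nCk (2 * (k + d)) k (d + (k + d))
               (solve 2 (λ k d → k :+ (d :+ (k :+ d)) := con 2 :* (k :+ d)) refl k d)) ⟩
    suc k * ((2 * (k + d)) C suc k) ∎
    where X = (2 * (k + d)) C k

  S₁-upper-step : ∀ n i e → i + e ≡ n →
    2 * (((2 * n) C (n + i)) * ∣ n - n + i ∣ ^ 1) + suc (n + i) * ((2 * n) C suc (n + i))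
      ≡ (n + i) * ((2 * n) C (n + i))
  S₁-upper-step .(i + e) i e refl = begin
    2 * (X * ∣ n - n + i ∣ ^ 1) + suc (n + i) * ((2 * n) C suc (n + i))
      ≡⟨ cong₂ (λ x y → 2 * (X * x) + y) (trans (*-identityʳ _) (∣m-m+n∣≡n n i))
               ([k+1]*nC[k+1]≡l*nCk (2 * n) (n + i) e
                  (solve 2 (λ i e → ((i :+ e) :+ i) :+ e := con 2 :* (i :+ e)) refl i e)) ⟩
    2 * (X * i) + e * X
      ≡⟨ solve 3 (λ X i e → con 2 :* (X :* i) :+ e :* X := ((i :+ e) :+ i) :* X) refl X i e ⟩
    (n + i) * X ∎
    where
    n = i + e
    X = (2 * n) C (n + i)

  S₁-lower-half : ∀ n → 2 * sumBelow n (λ k → ((2 * n) C k) * ∣ n - k ∣ ^ 1) ≡ n * ((2 * n) C n)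
  S₁-lower-half n = begin
    2 * sumBelow n t                   ≡⟨ sym (sumBelow-*ˡ n 2 t) ⟩
    sumBelow n (λ k → 2 * t k)         ≡⟨ sym (+-identityʳ _) ⟩
    sumBelow n (λ k → 2 * t k) + H 0   ≡⟨ telescope-up n (λ k → 2 * t k) H step ⟩
    H n ∎
    where
    t H : ℕ → ℕ
    t k = ((2 * n) C k) * ∣ n - k ∣ ^ 1
    H k = k * ((2 * n) C k)
    step : ∀ k → k < n → 2 * t k + H k ≡ H (suc k)
    step k k<n = let d , k+d≡n = m≤n⇒∃[o]m+o≡n (<⇒≤ k<n) in S₁-lower-step n k d k+d≡n

  2n+1≡n+[n+1] : ∀ n → suc (2 * n) ≡ n + suc n
  2n+1≡n+[n+1] n = solve 1 (λ n → con 1 :+ con 2 :* n := n :+ (con 1 :+ n)) refl n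

  S₁-upper-half : ∀ n → 2 * sumBelow (suc n) (λ i → ((2 * n) C (n + i)) * ∣ n - n + i ∣ ^ 1) ≡ n * ((2 * n) C n)
  S₁-upper-half n = begin
    2 * sumBelow (suc n) t                 ≡⟨ sym (sumBelow-*ˡ (suc n) 2 t) ⟩
    sumBelow (suc n) (λ i → 2 * t i)       ≡⟨ sym (+-identityʳ _) ⟩
    sumBelow (suc n) (λ i → 2 * t i) + 0   ≡⟨ cong (sumBelow (suc n) (λ i → 2 * t i) +_) (sym H[n+1]≡0) ⟩
    sumBelow (suc n) (λ i → 2 * t i) + H (suc n)
                                           ≡⟨ telescope-down (suc n) (λ i → 2 * t i) H step ⟩
    H 0                                    ≡⟨ cong (λ k → k * ((2 * n) C k)) (+-identityʳ n) ⟩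
    n * ((2 * n) C n) ∎
    where
    t H : ℕ → ℕ
    t i = ((2 * n) C (n + i)) * ∣ n - n + i ∣ ^ 1
    H i = (n + i) * ((2 * n) C (n + i))
    H[n+1]≡0 : H (suc n) ≡ 0
    H[n+1]≡0 = trans (cong ((n + suc n) *_) (k>n⇒nCk≡0 (≤-reflexive (2n+1≡n+[n+1] n)))) (*-zeroʳ (n + suc n))
    step : ∀ i → i < suc n → 2 * t i + H (suc i) ≡ H i
    step i (s≤s i≤n) = let e , i+e≡n = m≤n⇒∃[o]m+o≡n i≤n in
      trans (cong (λ k → 2 * t i + k * ((2 * n) C k)) (+-suc n i)) (S₁-upper-step n i e i+e≡n)

  -- Both halves telescope against k C(2n,k), because (k+1) C(2n,k+1) = (2n−k) C(2n,k).
  S[1,n]≡n*[2n]Cn : ∀ n → S 1 n ≡ n * ((2 * n) C n)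
  S[1,n]≡n*[2n]Cn n = *-cancelˡ-≡ _ _ 2 (begin
    2 * S 1 n                                                 ≡⟨ cong (2 *_) (S≡sumBelow 1 n) ⟩
    2 * sumBelow (suc (2 * n)) t                              ≡⟨ cong (λ L → 2 * sumBelow L t) (2n+1≡n+[n+1] n) ⟩
    2 * sumBelow (n + suc n) t                                ≡⟨ cong (2 *_) (sumBelow-+-range n (suc n) t) ⟩
    2 * (sumBelow n t + sumBelow (suc n) (λ i → t (n + i)))   ≡⟨ *-distribˡ-+ 2 (sumBelow n t) _ ⟩
    2 * sumBelow n t + 2 * sumBelow (suc n) (λ i → t (n + i)) ≡⟨ cong₂ _+_ (S₁-lower-half n) (S₁-upper-half n) ⟩
    c + c                                                     ≡⟨ cong (c +_) (sym (+-identityʳ c)) ⟩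
    2 * c ∎)
    where
    t : ℕ → ℕ
    t k = ((2 * n) C k) * ∣ n - k ∣ ^ 1
    c = n * ((2 * n) C n)

  ∣n-j∣²+[j+1]l≡[n+1]² : ∀ n j l → j + l ≡ suc (2 * n) → ∣ n - j ∣ * ∣ n - j ∣ + suc j * l ≡ suc n * suc n
  ∣n-j∣²+[j+1]l≡[n+1]² n j l j+l≡2n+1 with ≤-<-connex j n
  ... | inj₁ j≤n with m≤n⇒∃[o]m+o≡n j≤n
  ...   | d , refl with +-cancelˡ-≡ j l (suc (j + (d + d)))
                          (trans j+l≡2n+1 (solve 2 (λ j d → con 1 :+ con 2 :* (j :+ d) := j :+ (con 1 :+ (j :+ (d :+ d)))) refl j d))
  ...     | refl = begin
    ∣ j + d - j ∣ * ∣ j + d - j ∣ + suc j * suc (j + (d + d))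
      ≡⟨ cong (λ x → x * x + suc j * suc (j + (d + d))) (∣m+n-m∣≡n j d) ⟩
    d * d + suc j * suc (j + (d + d))
      ≡⟨ solve 2 (λ j d → d :* d :+ (con 1 :+ j) :* (con 1 :+ (j :+ (d :+ d))) := (con 1 :+ (j :+ d)) :* (con 1 :+ (j :+ d))) refl j d ⟩
    suc (j + d) * suc (j + d) ∎
  ∣n-j∣²+[j+1]l≡[n+1]² n j l j+l≡2n+1 | inj₂ n<j with m≤n⇒∃[o]m+o≡n n<j
  ...   | t , refl with +-cancelˡ-≡ (suc n) (t + l) n
                          (trans (sym (+-assoc (suc n) t l)) (trans j+l≡2n+1 (solve 1 (λ n → con 1 :+ con 2 :* n := (con 1 :+ n) :+ n) refl n)))
  ...     | refl = begin
    ∣ t + l - suc (t + l + t) ∣ * ∣ t + l - suc (t + l + t) ∣ + suc (suc (t + l + t)) * l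
      ≡⟨ cong (λ x → x * x + suc (suc (t + l + t)) * l) (trans (cong ∣ t + l -_∣ (sym (+-suc (t + l) t))) (∣m-m+n∣≡n (t + l) (suc t))) ⟩
    suc t * suc t + suc (suc (t + l + t)) * l
      ≡⟨ solve 2 (λ t l → (con 1 :+ t) :* (con 1 :+ t) :+ (con 2 :+ ((t :+ l) :+ t)) :* l := (con 1 :+ (t :+ l)) :* (con 1 :+ (t :+ l))) refl t l ⟩
    suc (t + l) * suc (t + l) ∎

  recurrence-coefficient-identity : ∀ n j → j < 2 + 2 * n →
    ((2 + 2 * n) C suc j) * (∣ n - j ∣ * ∣ n - j ∣) + ((2 + 2 * n) * (1 + 2 * n)) * ((2 * n) C j)
      ≡ (suc n * suc n) * ((2 + 2 * n) C suc j)
  recurrence-coefficient-identity n j (s≤s j≤2n+1) = begin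
    E * d² + (N * M₁) * A            ≡⟨ cong (E * d² +_) (*-assoc N M₁ A) ⟩
    E * d² + N * (M₁ * A)            ≡⟨ cong (λ x → E * d² + N * x) (sym (l*[n+1]Ck≡[n+1]*nCk (2 * n) j l j+l≡2n+1)) ⟩
    E * d² + N * (l * B)             ≡⟨ cong (E * d² +_) (x*yz≡y*xz N l B) ⟩
    E * d² + l * (N * B)             ≡⟨ cong (λ x → E * d² + l * x) (sym ([k+1]*[n+1]C[k+1]≡[n+1]*nCk M₁ j)) ⟩
    E * d² + l * (suc j * E)         ≡⟨ solve 4 (λ E d² l j → E :* d² :+ l :* (j :* E) := (d² :+ j :* l) :* E) refl E d² l (suc j) ⟩
    (d² + suc j * l) * E             ≡⟨ cong (_* E) (∣n-j∣²+[j+1]l≡[n+1]² n j l j+l≡2n+1) ⟩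
    (suc n * suc n) * E ∎
    where
    l = proj₁ (m≤n⇒∃[o]m+o≡n j≤2n+1)
    j+l≡2n+1 = proj₂ (m≤n⇒∃[o]m+o≡n j≤2n+1)
    M₁ = 1 + 2 * n
    N = 2 + 2 * n
    E = N C suc j
    A = (2 * n) C j
    B = M₁ C j
    d² = ∣ n - j ∣ * ∣ n - j ∣

  centralBinomial-suc : ∀ n → (suc n * suc n) * ((2 * suc n) C suc n) ≡ ((2 + 2 * n) * (1 + 2 * n)) * ((2 * n) C n)
  centralBinomial-suc n = begin
    (suc n * suc n) * ((2 * suc n) C suc n)    ≡⟨ cong (λ N → (suc n * suc n) * (N C suc n)) (*-suc 2 n) ⟩
    (suc n * suc n) * E                        ≡⟨ sym (recurrence-coefficient-identity n n (m≤n⇒m≤1+n (s≤s (m≤m+n n (n + 0))))) ⟩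
    E * (∣ n - n ∣ * ∣ n - n ∣) + K            ≡⟨ cong (λ x → E * (x * x) + K) (∣n-n∣≡0 n) ⟩
    E * 0 + K                                  ≡⟨ cong (_+ K) (*-zeroʳ E) ⟩
    K ∎
    where
    E = (2 + 2 * n) C suc n
    K = ((2 + 2 * n) * (1 + 2 * n)) * ((2 * n) C n)

  S-recurrence-summand : ∀ m n j → j < 2 + 2 * n →
    ((2 + 2 * n) C suc j) * ∣ n - j ∣ ^ (2 + m) + ((2 + 2 * n) * (1 + 2 * n)) * (((2 * n) C j) * ∣ n - j ∣ ^ m)
      ≡ (suc n * suc n) * (((2 + 2 * n) C suc j) * ∣ n - j ∣ ^ m)
  S-recurrence-summand m n j j<N = begin
    E * (d * (d * D)) + c * (A * D)  ≡⟨ solve 5 (λ E d D c A → E :* (d :* (d :* D)) :+ c :* (A :* D) := (E :* (d :* d) :+ c :* A) :* D)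
                                          refl E d D c A ⟩
    (E * (d * d) + c * A) * D        ≡⟨ cong (_* D) (recurrence-coefficient-identity n j j<N) ⟩
    (suc n * suc n * E) * D          ≡⟨ *-assoc (suc n * suc n) E D ⟩
    suc n * suc n * (E * D) ∎
    where
    E = (2 + 2 * n) C suc j
    A = (2 * n) C j
    c = (2 + 2 * n) * (1 + 2 * n)
    d = ∣ n - j ∣
    D = d ^ m

  S[m,1+n]≡sumBelow : ∀ m n → S m (suc n) ≡ sumBelow (3 + 2 * n) (λ k → ((2 + 2 * n) C k) * ∣ suc n - k ∣ ^ m)
  S[m,1+n]≡sumBelow m n = trans (S≡sumBelow m (suc n))
                       (cong (λ N → sumBelow (suc N) (λ k → (N C k) * ∣ suc n - k ∣ ^ m)) (*-suc 2 n))

  S-recurrence : ∀ m n → S (2 + m) (suc n) + ((2 + 2 * n) * (1 + 2 * n)) * S m n ≡ (suc n * suc n) * S m (suc n)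
  S-recurrence m n = begin
    S (2 + m) (suc n) + c * S m n                        ≡⟨ cong₂ (λ x y → x + c * y) (S[m,1+n]≡sumBelow (2 + m) n) (S≡sumBelow m n) ⟩
    (F 0 + sumBelow N F′) + c * sumBelow (suc M) G       ≡⟨ cong (λ x → (F 0 + sumBelow N F′) + c * x) G-range ⟩
    (F 0 + sumBelow N F′) + c * sumBelow N G             ≡⟨ cong ((F 0 + sumBelow N F′) +_) (sym (sumBelow-*ˡ N c G)) ⟩
    (F 0 + sumBelow N F′) + sumBelow N (λ j → c * G j)   ≡⟨ +-assoc (F 0) _ _ ⟩
    F 0 + (sumBelow N F′ + sumBelow N (λ j → c * G j))   ≡⟨ cong (F 0 +_) (sym (sumBelow-+ N F′ (λ j → c * G j))) ⟩
    F 0 + sumBelow N (λ j → F′ j + c * G j)              ≡⟨ cong (F 0 +_) (sumBelow-cong N (S-recurrence-summand m n)) ⟩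
    F 0 + sumBelow N (λ j → s² * H′ j)                   ≡⟨ cong (F 0 +_) (sumBelow-*ˡ N s² H′) ⟩
    F 0 + s² * sumBelow N H′                             ≡⟨ cong (_+ s² * sumBelow N H′) F0≡s²H0 ⟩
    s² * H 0 + s² * sumBelow N H′                        ≡⟨ sym (*-distribˡ-+ s² (H 0) _) ⟩
    s² * (H 0 + sumBelow N H′)                           ≡⟨ cong (s² *_) (sym (S[m,1+n]≡sumBelow m n)) ⟩
    s² * S m (suc n) ∎
    where
    M = 2 * n
    N = 2 + M
    s² = suc n * suc n
    c = N * (1 + M)
    F H : ℕ → ℕ
    F k = (N C k) * ∣ suc n - k ∣ ^ (2 + m)
    H k = (N C k) * ∣ suc n - k ∣ ^ m
    F′ H′ G : ℕ → ℕ
    F′ j = F (suc j)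
    H′ j = H (suc j)
    G j = (M C j) * ∣ n - j ∣ ^ m
    G-range : sumBelow (suc M) G ≡ sumBelow N G
    G-range = sym (trans (sumBelow-suc (suc M) G)
                         (trans (cong (λ x → sumBelow (suc M) G + x * ∣ n - suc M ∣ ^ m) (k>n⇒nCk≡0 (n<1+n M)))
                                (+-identityʳ _)))
    F0≡s²H0 : F 0 ≡ s² * H 0
    F0≡s²H0 = solve 2 (λ s P → con 1 :* (s :* (s :* P)) := (s :* s) :* (con 1 :* P)) refl (suc n) (suc n ^ m)

open import Data.Integer as ℤ using (+_; -[1+_]; 1ℤ)
import Data.Integer.Properties as ℤP
open import Data.Integer.Tactic.RingSolver using (solve-∀)
open import Data.Rational as ℚ using (ℚ; 0ℚ; 1ℚ; ½; _+_; _*_; _-_; -_; 1/_)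
open import Data.Rational.Properties
import Data.Rational.Unnormalised as ℚᵘ
import Data.Rational.Unnormalised.Properties as ℚᵘ
open import Data.Rational.Solver using (module +-*-Solver)
open +-*-Solver
open import Algebra.Properties.Group +-0-group using (x∙y⁻¹≈ε⇒x≈y; x≈y⇒x∙y⁻¹≈ε)

-- Rational arithmetic

toℚᵘ-ℕtoℚ : ∀ k → ℚ.toℚᵘ (ℕtoℚ k) ℚᵘ.≃ ℚᵘ.mkℚᵘ (+ k) 0
toℚᵘ-ℕtoℚ k = toℚᵘ-fromℚᵘ (ℚᵘ.mkℚᵘ (+ k) 0)

ℕtoℚ-suc : ∀ k → ℕtoℚ (suc k) ≡ 1ℚ + ℕtoℚ k
ℕtoℚ-suc k = toℚᵘ-injective (begin
  ℚ.toℚᵘ (ℕtoℚ (suc k))                               ≈⟨ toℚᵘ-ℕtoℚ (suc k) ⟩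
  ℚᵘ.mkℚᵘ (+ suc k) 0                                 ≈⟨ ℚᵘ.*≡* (sym cross-multiplied) ⟩
  ℚᵘ.mkℚᵘ (+ 1) 0 ℚᵘ.+ ℚᵘ.mkℚᵘ (+ k) 0                ≈⟨ ℚᵘ.+-cong (toℚᵘ-ℕtoℚ 1) (toℚᵘ-ℕtoℚ k) ⟨
  ℚ.toℚᵘ 1ℚ ℚᵘ.+ ℚ.toℚᵘ (ℕtoℚ k)                      ≈⟨ toℚᵘ-homo-+ 1ℚ (ℕtoℚ k) ⟨
  ℚ.toℚᵘ (1ℚ + ℕtoℚ k) ∎)
  where
  open ℚᵘ.≃-Reasoning
  cross-multiplied : (+ 1 ℤ.* + 1 ℤ.+ + k ℤ.* + 1) ℤ.* + 1 ≡ + suc k ℤ.* (+ 1 ℤ.* + 1)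
  cross-multiplied rewrite ℤP.*-identityʳ (+ k) | ℤP.*-identityʳ (+ suc k) = refl

ℕtoℚ-+ : ∀ a b → ℕtoℚ (a ℕ.+ b) ≡ ℕtoℚ a + ℕtoℚ b
ℕtoℚ-+ zero    b = sym (+-identityˡ (ℕtoℚ b))
ℕtoℚ-+ (suc a) b = begin
  ℕtoℚ (suc (a ℕ.+ b))         ≡⟨ ℕtoℚ-suc (a ℕ.+ b) ⟩
  1ℚ + ℕtoℚ (a ℕ.+ b)          ≡⟨ cong (λ y → 1ℚ + y) (ℕtoℚ-+ a b) ⟩
  1ℚ + (ℕtoℚ a + ℕtoℚ b)       ≡⟨ +-assoc 1ℚ (ℕtoℚ a) (ℕtoℚ b) ⟨
  (1ℚ + ℕtoℚ a) + ℕtoℚ b       ≡⟨ cong (_+ ℕtoℚ b) (ℕtoℚ-suc a) ⟨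
  ℕtoℚ (suc a) + ℕtoℚ b ∎
  where open ≡-Reasoning

ℕtoℚ-* : ∀ a b → ℕtoℚ (a ℕ.* b) ≡ ℕtoℚ a * ℕtoℚ b
ℕtoℚ-* zero    b = sym (*-zeroˡ (ℕtoℚ b))
ℕtoℚ-* (suc a) b = begin
  ℕtoℚ (b ℕ.+ a ℕ.* b)         ≡⟨ ℕtoℚ-+ b (a ℕ.* b) ⟩
  ℕtoℚ b + ℕtoℚ (a ℕ.* b)      ≡⟨ cong (λ y → ℕtoℚ b + y) (ℕtoℚ-* a b) ⟩
  ℕtoℚ b + ℕtoℚ a * ℕtoℚ b     ≡⟨ solve 2 (λ a b → b :+ a :* b := (con 1ℚ :+ a) :* b) refl (ℕtoℚ a) (ℕtoℚ b) ⟩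
  (1ℚ + ℕtoℚ a) * ℕtoℚ b       ≡⟨ cong (_* ℕtoℚ b) (ℕtoℚ-suc a) ⟨
  ℕtoℚ (suc a) * ℕtoℚ b ∎
  where open ≡-Reasoning

ℕtoℚ-*₃ : ∀ a b c → ℕtoℚ (a ℕ.* b ℕ.* c) ≡ ℕtoℚ a * ℕtoℚ b * ℕtoℚ c
ℕtoℚ-*₃ a b c = trans (ℕtoℚ-* (a ℕ.* b) c) (cong (_* ℕtoℚ c) (ℕtoℚ-* a b))

ℕtoℚ-a+2n : ∀ a n → ℕtoℚ (a ℕ.+ 2 ℕ.* n) ≡ ℕtoℚ a + ℕtoℚ 2 * ℕtoℚ n
ℕtoℚ-a+2n a n = trans (ℕtoℚ-+ a (2 ℕ.* n)) (cong (λ y → ℕtoℚ a + y) (ℕtoℚ-* 2 n))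

ℕtoℚ-suc-1 : ∀ n → ℕtoℚ (suc n) - 1ℚ ≡ ℕtoℚ n
ℕtoℚ-suc-1 n = trans (cong (_- 1ℚ) (ℕtoℚ-suc n)) (solve 1 (λ y → (con 1ℚ :+ y) :- con 1ℚ := y) refl (ℕtoℚ n))

ℕtoℚ-≢0 : ∀ k → .{{NonZero k}} → ℕtoℚ k ≢ 0ℚ
ℕtoℚ-≢0 (suc k) k+1≡0 with ℚᵘ.≃-trans (ℚᵘ.≃-sym (toℚᵘ-ℕtoℚ (suc k))) (toℚᵘ-cong k+1≡0)
... | ℚᵘ.*≡* ()

ℕtoℚ-difference≢0 : ∀ {k n} → k ℕ.< n → ℕtoℚ n - ℕtoℚ k ≢ 0ℚ
ℕtoℚ-difference≢0 {k} {n} k<n with ℕP.m≤n⇒∃[o]m+o≡n k<n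
... | t , k+1+t≡n = subst (_≢ 0ℚ) n-k≡t+1 (ℕtoℚ-≢0 (suc t))
  where
  n-k≡t+1 : ℕtoℚ (suc t) ≡ ℕtoℚ n - ℕtoℚ k
  n-k≡t+1 = begin
    ℕtoℚ (suc t)                          ≡⟨ solve 2 (λ K T → T := (K :+ T) :- K) refl (ℕtoℚ k) (ℕtoℚ (suc t)) ⟩
    (ℕtoℚ k + ℕtoℚ (suc t)) - ℕtoℚ k      ≡⟨ cong (_- ℕtoℚ k) (ℕtoℚ-+ k (suc t)) ⟨
    ℕtoℚ (k ℕ.+ suc t) - ℕtoℚ k           ≡⟨ cong (λ m → ℕtoℚ m - ℕtoℚ k) (trans (ℕP.+-suc k t) k+1+t≡n) ⟩
    ℕtoℚ n - ℕtoℚ k ∎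
    where open ≡-Reasoning

*-cancelʳ-≢0 : ∀ p q r → r ≢ 0ℚ → p * r ≡ q * r → p ≡ q
*-cancelʳ-≢0 p q r r≢0 pr≡qr = begin
  p                   ≡⟨ *-identityʳ p ⟨
  p * 1ℚ              ≡⟨ cong (p *_) (*-inverseʳ r) ⟨
  p * (r * 1/ r)      ≡⟨ *-assoc p r (1/ r) ⟨
  (p * r) * 1/ r      ≡⟨ cong (_* 1/ r) pr≡qr ⟩
  (q * r) * 1/ r      ≡⟨ *-assoc q r (1/ r) ⟩
  q * (r * 1/ r)      ≡⟨ cong (q *_) (*-inverseʳ r) ⟩
  q * 1ℚ              ≡⟨ *-identityʳ q ⟩
  q ∎
  where
  open ≡-Reasoning
  instance _ = ℚ.≢-nonZero r≢0

*-≢0 : ∀ p q → p ≢ 0ℚ → q ≢ 0ℚ → p * q ≢ 0ℚ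
*-≢0 p q p≢0 q≢0 pq≡0 = p≢0 (*-cancelʳ-≢0 p 0ℚ q q≢0 (trans pq≡0 (sym (*-zeroˡ q))))

a+b≡c⇒a≡c-b : ∀ a b c → a + b ≡ c → a ≡ c - b
a+b≡c⇒a≡c-b a b c a+b≡c =
  trans (solve 2 (λ a b → a := (a :+ b) :- b) refl a b) (cong (_- b) a+b≡c)

S-recurrenceℚ : ∀ m n → ℕtoℚ (S (2 ℕ.+ m) (suc n)) ≡
  ℕtoℚ (suc n) * ℕtoℚ (suc n) * ℕtoℚ (S m (suc n)) - ℕtoℚ (2 ℕ.+ 2 ℕ.* n) * ℕtoℚ (1 ℕ.+ 2 ℕ.* n) * ℕtoℚ (S m n)
S-recurrenceℚ m n = a+b≡c⇒a≡c-b _ _ _ (begin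
  ℕtoℚ (S (2 ℕ.+ m) (suc n)) + ℕtoℚ (2 ℕ.+ 2 ℕ.* n) * ℕtoℚ (1 ℕ.+ 2 ℕ.* n) * ℕtoℚ (S m n)
    ≡⟨ cong (λ y → ℕtoℚ (S (2 ℕ.+ m) (suc n)) + y) (ℕtoℚ-*₃ (2 ℕ.+ 2 ℕ.* n) (1 ℕ.+ 2 ℕ.* n) (S m n)) ⟨
  ℕtoℚ (S (2 ℕ.+ m) (suc n)) + ℕtoℚ ((2 ℕ.+ 2 ℕ.* n) ℕ.* (1 ℕ.+ 2 ℕ.* n) ℕ.* S m n)
    ≡⟨ ℕtoℚ-+ (S (2 ℕ.+ m) (suc n)) _ ⟨
  ℕtoℚ (S (2 ℕ.+ m) (suc n) ℕ.+ (2 ℕ.+ 2 ℕ.* n) ℕ.* (1 ℕ.+ 2 ℕ.* n) ℕ.* S m n)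
    ≡⟨ cong ℕtoℚ (S-recurrence m n) ⟩
  ℕtoℚ (suc n ℕ.* suc n ℕ.* S m (suc n))
    ≡⟨ ℕtoℚ-*₃ (suc n) (suc n) (S m (suc n)) ⟩
  ℕtoℚ (suc n) * ℕtoℚ (suc n) * ℕtoℚ (S m (suc n)) ∎)
  where open ≡-Reasoning

centralBinomialℚ : ∀ n → ℕtoℚ (2 ℕ.+ 2 ℕ.* n) * ℕtoℚ (1 ℕ.+ 2 ℕ.* n) * ℕtoℚ ((2 ℕ.* n) C n) ≡
  ℕtoℚ (suc n) * ℕtoℚ (suc n) * ℕtoℚ ((2 ℕ.* suc n) C suc n)
centralBinomialℚ n = begin
  ℕtoℚ (2 ℕ.+ 2 ℕ.* n) * ℕtoℚ (1 ℕ.+ 2 ℕ.* n) * ℕtoℚ ((2 ℕ.* n) C n)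
    ≡⟨ ℕtoℚ-*₃ (2 ℕ.+ 2 ℕ.* n) (1 ℕ.+ 2 ℕ.* n) ((2 ℕ.* n) C n) ⟨
  ℕtoℚ ((2 ℕ.+ 2 ℕ.* n) ℕ.* (1 ℕ.+ 2 ℕ.* n) ℕ.* ((2 ℕ.* n) C n))
    ≡⟨ cong ℕtoℚ (centralBinomial-suc n) ⟨
  ℕtoℚ (suc n ℕ.* suc n ℕ.* ((2 ℕ.* suc n) C suc n))
    ≡⟨ ℕtoℚ-*₃ (suc n) (suc n) ((2 ℕ.* suc n) C suc n) ⟩
  ℕtoℚ (suc n) * ℕtoℚ (suc n) * ℕtoℚ ((2 ℕ.* suc n) C suc n) ∎
  where open ≡-Reasoning

powℚ-≢0 : ∀ q k → q ≢ 0ℚ → powℚ q k ≢ 0ℚ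
powℚ-≢0 q zero    _   = 1≢0
powℚ-≢0 q (suc k) q≢0 = *-≢0 q (powℚ q k) q≢0 (powℚ-≢0 q k q≢0)

twoPow-≢0 : ∀ z → twoPow z ≢ 0ℚ
twoPow-≢0 (+ k)    = powℚ-≢0 (ℕtoℚ 2) k (ℕtoℚ-≢0 2)
twoPow-≢0 -[1+ k ] = powℚ-≢0 ½ (suc k) (λ ())

twoPow-suc : ∀ z → twoPow (ℤ.suc z) ≡ ℕtoℚ 2 * twoPow z
twoPow-suc (+ k)          = refl
twoPow-suc -[1+ zero ]    = refl
twoPow-suc -[1+ suc k ]   =
  solve 1 (λ P → con ½ :* P := con (ℕtoℚ 2) :* (con ½ :* (con ½ :* P))) refl (powℚ ½ k)

ℕtoℚ-2^ : ∀ k → ℕtoℚ (2 ℕ.^ k) ≡ powℚ (ℕtoℚ 2) k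
ℕtoℚ-2^ zero    = refl
ℕtoℚ-2^ (suc k) = trans (ℕtoℚ-* 2 (2 ℕ.^ k)) (cong (ℕtoℚ 2 *_) (ℕtoℚ-2^ k))

twoPow-2[n+1]-r : ∀ n r → twoPow (+ (2 ℕ.* suc n) ℤ.- + r) ≡ ℕtoℚ 2 * (ℕtoℚ 2 * twoPow (+ (2 ℕ.* n) ℤ.- + r))
twoPow-2[n+1]-r n r = begin
  twoPow (+ (2 ℕ.* suc n) ℤ.- + r)        ≡⟨ cong (λ k → twoPow (+ k ℤ.- + r)) (ℕP.*-suc 2 n) ⟩
  twoPow (ℤ.suc (ℤ.suc z) ℤ.- + r)        ≡⟨ cong twoPow (exponent z (+ r)) ⟩
  twoPow (ℤ.suc (ℤ.suc (z ℤ.- + r)))      ≡⟨ twoPow-suc (ℤ.suc (z ℤ.- + r)) ⟩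
  ℕtoℚ 2 * twoPow (ℤ.suc (z ℤ.- + r))     ≡⟨ cong (ℕtoℚ 2 *_) (twoPow-suc (z ℤ.- + r)) ⟩
  ℕtoℚ 2 * (ℕtoℚ 2 * twoPow (z ℤ.- + r)) ∎
  where
  open ≡-Reasoning
  z = + (2 ℕ.* n)
  exponent : ∀ a b → 1ℤ ℤ.+ (1ℤ ℤ.+ a) ℤ.- b ≡ 1ℤ ℤ.+ (1ℤ ℤ.+ (a ℤ.- b))
  exponent = solve-∀

twoPow-2[n+1]-[r+1] : ∀ n r → twoPow (+ (2 ℕ.* suc n) ℤ.- + suc r) ≡ ℕtoℚ 2 * twoPow (+ (2 ℕ.* n) ℤ.- + r)
twoPow-2[n+1]-[r+1] n r = begin
  twoPow (+ (2 ℕ.* suc n) ℤ.- + suc r)          ≡⟨ cong (λ k → twoPow (+ k ℤ.- + suc r)) (ℕP.*-suc 2 n) ⟩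
  twoPow (ℤ.suc (ℤ.suc z) ℤ.- ℤ.suc (+ r))      ≡⟨ cong twoPow (exponent z (+ r)) ⟩
  twoPow (ℤ.suc (z ℤ.- + r))                    ≡⟨ twoPow-suc (z ℤ.- + r) ⟩
  ℕtoℚ 2 * twoPow (z ℤ.- + r) ∎
  where
  open ≡-Reasoning
  z = + (2 ℕ.* n)
  exponent : ∀ a b → 1ℤ ℤ.+ (1ℤ ℤ.+ a) ℤ.- (1ℤ ℤ.+ b) ≡ 1ℤ ℤ.+ (a ℤ.- b)
  exponent = solve-∀

-- Polynomials

infixl 6 _+ₚ_
infix  8 -ₚ_ X*_

_+ₚ_ : Poly → Poly → Poly
[]      +ₚ q       = q
(a ∷ p) +ₚ []      = a ∷ p
(a ∷ p) +ₚ (b ∷ q) = (a + b) ∷ (p +ₚ q)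

-ₚ_ : Poly → Poly
-ₚ []      = []
-ₚ (a ∷ p) = - a ∷ -ₚ p

X*_ : Poly → Poly
X* []      = []
X* (a ∷ p) = 0ℚ ∷ a ∷ p

-- For p = a + X q: p(x) − p(x−1) = x (∇ q)(x) + q(x) − (∇ q)(x).
∇ : Poly → Poly
∇ []      = []
∇ (a ∷ p) = X* ∇ p +ₚ (p +ₚ -ₚ ∇ p)

eval-+ₚ : ∀ p q x → eval (p +ₚ q) x ≡ eval p x + eval q x
eval-+ₚ []      q       x = sym (+-identityˡ (eval q x))
eval-+ₚ (a ∷ p) []      x = sym (+-identityʳ (eval (a ∷ p) x))
eval-+ₚ (a ∷ p) (b ∷ q) x = begin
  (a + b) + x * eval (p +ₚ q) x            ≡⟨ cong (λ y → (a + b) + x * y) (eval-+ₚ p q x) ⟩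
  (a + b) + x * (eval p x + eval q x)      ≡⟨ solve 5 (λ a b x P Q → (a :+ b) :+ x :* (P :+ Q) := (a :+ x :* P) :+ (b :+ x :* Q))
                                                refl a b x (eval p x) (eval q x) ⟩
  (a + x * eval p x) + (b + x * eval q x) ∎
  where open ≡-Reasoning

eval--ₚ : ∀ p x → eval (-ₚ p) x ≡ - eval p x
eval--ₚ []      x = refl
eval--ₚ (a ∷ p) x = begin
  - a + x * eval (-ₚ p) x     ≡⟨ cong (λ y → - a + x * y) (eval--ₚ p x) ⟩
  - a + x * - eval p x        ≡⟨ solve 3 (λ a x P → (:- a) :+ x :* (:- P) := :- (a :+ x :* P)) refl a x (eval p x) ⟩
  - (a + x * eval p x) ∎
  where open ≡-Reasoning

eval-X* : ∀ p x → eval (X* p) x ≡ x * eval p x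
eval-X* []      x = sym (*-zeroʳ x)
eval-X* (a ∷ p) x = +-identityˡ (x * eval (a ∷ p) x)

eval-constant : ∀ a x → eval (a ∷ []) x ≡ a
eval-constant a x = trans (cong (λ y → a + y) (*-zeroʳ x)) (+-identityʳ a)

eval-∇ : ∀ p x → eval (∇ p) x ≡ eval p x - eval p (x - 1ℚ)
eval-∇ []      x = refl
eval-∇ (a ∷ p) x = begin
  eval (X* ∇ p +ₚ (p +ₚ -ₚ ∇ p)) x
    ≡⟨ eval-+ₚ (X* ∇ p) (p +ₚ -ₚ ∇ p) x ⟩
  eval (X* ∇ p) x + eval (p +ₚ -ₚ ∇ p) x
    ≡⟨ cong₂ _+_ (eval-X* (∇ p) x) (trans (eval-+ₚ p (-ₚ ∇ p) x) (cong (λ y → eval p x + y) (eval--ₚ (∇ p) x))) ⟩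
  x * eval (∇ p) x + (eval p x + - eval (∇ p) x)
    ≡⟨ cong (λ y → x * y + (eval p x + - y)) (eval-∇ p x) ⟩
  x * (P - P′) + (P + - (P - P′))
    ≡⟨ solve 4 (λ a x P P′ → x :* (P :- P′) :+ (P :+ (:- (P :- P′))) := (a :+ x :* P) :- (a :+ (x :- con 1ℚ) :* P′))
         refl a x P P′ ⟩
  (a + x * P) - (a + (x - 1ℚ) * P′) ∎
  where
  open ≡-Reasoning
  P = eval p x
  P′ = eval p (x - 1ℚ)

coef : Poly → ℕ → ℚ
coef []      k       = 0ℚ
coef (a ∷ p) zero    = a
coef (a ∷ p) (suc k) = coef p k

coef-+ₚ : ∀ p q k → coef (p +ₚ q) k ≡ coef p k + coef q k
coef-+ₚ []      q       k       = sym (+-identityˡ (coef q k))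
coef-+ₚ (a ∷ p) []      k       = sym (+-identityʳ (coef (a ∷ p) k))
coef-+ₚ (a ∷ p) (b ∷ q) zero    = refl
coef-+ₚ (a ∷ p) (b ∷ q) (suc k) = coef-+ₚ p q k

coef--ₚ : ∀ p k → coef (-ₚ p) k ≡ - coef p k
coef--ₚ []      k       = refl
coef--ₚ (a ∷ p) zero    = refl
coef--ₚ (a ∷ p) (suc k) = coef--ₚ p k

coef-X*-zero : ∀ p → coef (X* p) 0 ≡ 0ℚ
coef-X*-zero []      = refl
coef-X*-zero (a ∷ p) = refl

coef-X*-suc : ∀ p k → coef (X* p) (suc k) ≡ coef p k
coef-X*-suc []      k = refl
coef-X*-suc (a ∷ p) k = refl

coef-≥length : ∀ p k → length p ℕ.≤ k → coef p k ≡ 0ℚ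
coef-≥length []      k       _         = refl
coef-≥length (a ∷ p) (suc k) (s≤s p≤k) = coef-≥length p k p≤k

length-+ₚ : ∀ {d} p q → length p ℕ.≤ d → length q ℕ.≤ d → length (p +ₚ q) ℕ.≤ d
length-+ₚ []      q       _         q≤d       = q≤d
length-+ₚ (a ∷ p) []      p≤d       _         = p≤d
length-+ₚ (a ∷ p) (b ∷ q) (s≤s p≤d) (s≤s q≤d) = s≤s (length-+ₚ p q p≤d q≤d)

length--ₚ : ∀ p → length (-ₚ p) ≡ length p
length--ₚ []      = refl
length--ₚ (a ∷ p) = cong suc (length--ₚ p)

length-X* : ∀ {d} p → length p ℕ.≤ d → length (X* p) ℕ.≤ suc d
length-X* []      _   = z≤n
length-X* (a ∷ p) p≤d = s≤s p≤d

length-∇ : ∀ d p → length p ℕ.≤ suc d → length (∇ p) ℕ.≤ d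
length-∇ d       []          _               = z≤n
length-∇ zero    (a ∷ [])    _               = z≤n
length-∇ zero    (a ∷ b ∷ p) (s≤s ())
length-∇ (suc d) (a ∷ p)     (s≤s p≤d+1)     =
  length-+ₚ (X* ∇ p) (p +ₚ -ₚ ∇ p) (length-X* (∇ p) ∇p≤d)
    (length-+ₚ p (-ₚ ∇ p) p≤d+1 (subst (ℕ._≤ suc d) (sym (length--ₚ (∇ p))) (ℕP.m≤n⇒m≤1+n ∇p≤d)))
  where ∇p≤d = length-∇ d p p≤d+1

coef-∇ : ∀ d p → length p ℕ.≤ suc (suc d) → coef (∇ p) d ≡ ℕtoℚ (suc d) * coef p (suc d)
coef-∇ d       []      _           = sym (*-zeroʳ (ℕtoℚ (suc d)))
coef-∇ zero    (a ∷ p) (s≤s p≤1)   = begin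
  coef (X* ∇ p +ₚ (p +ₚ -ₚ ∇ p)) 0          ≡⟨ coef-+ₚ (X* ∇ p) (p +ₚ -ₚ ∇ p) 0 ⟩
  coef (X* ∇ p) 0 + coef (p +ₚ -ₚ ∇ p) 0     ≡⟨ cong₂ _+_ (coef-X*-zero (∇ p)) (coef-+ₚ p (-ₚ ∇ p) 0) ⟩
  0ℚ + (coef p 0 + coef (-ₚ ∇ p) 0)          ≡⟨ cong (λ y → 0ℚ + (coef p 0 + y)) (trans (coef--ₚ (∇ p) 0) (cong -_ (coef-≥length (∇ p) 0 (length-∇ 0 p p≤1)))) ⟩
  0ℚ + (coef p 0 + - 0ℚ)                     ≡⟨ solve 1 (λ c → con 0ℚ :+ (c :+ (:- con 0ℚ)) := con 1ℚ :* c) refl (coef p 0) ⟩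
  1ℚ * coef p 0 ∎
  where open ≡-Reasoning
coef-∇ (suc d) (a ∷ p) (s≤s p≤d+2) = begin
  coef (X* ∇ p +ₚ (p +ₚ -ₚ ∇ p)) (suc d)
    ≡⟨ coef-+ₚ (X* ∇ p) (p +ₚ -ₚ ∇ p) (suc d) ⟩
  coef (X* ∇ p) (suc d) + coef (p +ₚ -ₚ ∇ p) (suc d)
    ≡⟨ cong₂ _+_ (trans (coef-X*-suc (∇ p) d) (coef-∇ d p p≤d+2)) (coef-+ₚ p (-ₚ ∇ p) (suc d)) ⟩
  ℕtoℚ (suc d) * c + (c + coef (-ₚ ∇ p) (suc d))
    ≡⟨ cong (λ y → ℕtoℚ (suc d) * c + (c + y)) (trans (coef--ₚ (∇ p) (suc d)) (cong -_ (coef-≥length (∇ p) (suc d) (length-∇ (suc d) p p≤d+2)))) ⟩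
  ℕtoℚ (suc d) * c + (c + - 0ℚ)
    ≡⟨ solve 2 (λ n c → n :* c :+ (c :+ (:- con 0ℚ)) := (con 1ℚ :+ n) :* c) refl (ℕtoℚ (suc d)) c ⟩
  (1ℚ + ℕtoℚ (suc d)) * c
    ≡⟨ cong (_* c) (ℕtoℚ-suc (suc d)) ⟨
  ℕtoℚ (suc (suc d)) * c ∎
  where
  open ≡-Reasoning
  c = coef p (suc d)

lead≡coef : ∀ d p → length p ℕ.≤ suc d → coef p d ≢ 0ℚ → lead p ≡ coef p d
lead≡coef d       []          _         coef≢0 = ⊥-elim (coef≢0 refl)
lead≡coef zero    (a ∷ [])    _         coef≢0 = refl
lead≡coef zero    (a ∷ b ∷ p) (s≤s ())  coef≢0
lead≡coef (suc d) (a ∷ p)     (s≤s p≤d) coef≢0 with lead p ℚ.≟ 0ℚ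
... | yes lead≡0 = ⊥-elim (coef≢0 (trans (sym (lead≡coef d p p≤d coef≢0)) lead≡0))
... | no  _      = lead≡coef d p p≤d coef≢0

IsZero : Poly → Set
IsZero = All (_≡ 0ℚ)

lead-IsZero : ∀ p → IsZero p → lead p ≡ 0ℚ
lead-IsZero []      []            = refl
lead-IsZero (a ∷ p) (a≡0 ∷ p≡0) with lead p ℚ.≟ 0ℚ
... | yes _       = a≡0
... | no  lead≢0  = ⊥-elim (lead≢0 (lead-IsZero p p≡0))

lead-∷-cong : ∀ b p q → lead p ≡ lead q → lead (b ∷ p) ≡ lead (b ∷ q)
lead-∷-cong b p q lp≡lq with lead p ℚ.≟ 0ℚ | lead q ℚ.≟ 0ℚ
... | yes _     | yes _     = refl
... | yes lp≡0  | no  lq≢0  = ⊥-elim (lq≢0 (trans (sym lp≡lq) lp≡0))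
... | no  lp≢0  | yes lq≡0  = ⊥-elim (lp≢0 (trans lp≡lq lq≡0))
... | no  _     | no  _     = lp≡lq

IsZero--ₚ : ∀ q → IsZero (-ₚ q) → IsZero q
IsZero--ₚ []      []             = []
IsZero--ₚ (a ∷ q) (-a≡0 ∷ -q≡0) = neg-injective -a≡0 ∷ IsZero--ₚ q -q≡0

lead-cong-IsZero-difference : ∀ p q → IsZero (p +ₚ -ₚ q) → lead p ≡ lead q
lead-cong-IsZero-difference []      q       -q≡0          = sym (lead-IsZero q (IsZero--ₚ q -q≡0))
lead-cong-IsZero-difference (a ∷ p) []      p≡0           = lead-IsZero (a ∷ p) p≡0
lead-cong-IsZero-difference (a ∷ p) (b ∷ q) (a-b≡0 ∷ p-q≡0) =
  subst (λ c → lead (c ∷ p) ≡ lead (b ∷ q)) (sym (x∙y⁻¹≈ε⇒x≈y a b a-b≡0))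
        (lead-∷-cong b p q (lead-cong-IsZero-difference p q p-q≡0))

quotByLinear : ℚ → Poly → Poly
quotByLinear c []          = []
quotByLinear c (a ∷ [])    = []
quotByLinear c (a ∷ b ∷ p) = eval (b ∷ p) c ∷ quotByLinear c (b ∷ p)

eval-quotByLinear : ∀ c p x → eval p x ≡ eval p c + (x - c) * eval (quotByLinear c p) x
eval-quotByLinear c []          x = solve 2 (λ x c → con 0ℚ := con 0ℚ :+ (x :- c) :* con 0ℚ) refl x c
eval-quotByLinear c (a ∷ [])    x =
  solve 3 (λ a x c → a :+ x :* con 0ℚ := (a :+ c :* con 0ℚ) :+ (x :- c) :* con 0ℚ) refl a x c
eval-quotByLinear c (a ∷ b ∷ p) x = begin
  a + x * eval (b ∷ p) x              ≡⟨ cong (λ y → a + x * y) (eval-quotByLinear c (b ∷ p) x) ⟩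
  a + x * (B + (x - c) * D)           ≡⟨ solve 5 (λ a x c B D → a :+ x :* (B :+ (x :- c) :* D) := (a :+ c :* B) :+ (x :- c) :* (B :+ x :* D))
                                           refl a x c B D ⟩
  (a + c * B) + (x - c) * (B + x * D) ∎
  where
  open ≡-Reasoning
  B = eval (b ∷ p) c
  D = eval (quotByLinear c (b ∷ p)) x

length-quotByLinear : ∀ c a p → length (quotByLinear c (a ∷ p)) ≡ length p
length-quotByLinear c a []      = refl
length-quotByLinear c a (b ∷ p) = cong suc (length-quotByLinear c b p)

IsZero-quotByLinear : ∀ c p → IsZero (quotByLinear c p) → eval p c ≡ 0ℚ → IsZero p
IsZero-quotByLinear c []          _              _      = []
IsZero-quotByLinear c (a ∷ [])    _              p[c]≡0 =
  trans (solve 2 (λ a c → a := a :+ c :* con 0ℚ) refl a c) p[c]≡0 ∷ []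
IsZero-quotByLinear c (a ∷ b ∷ p) (q₀≡0 ∷ q≡0)   p[c]≡0 =
  trans (solve 2 (λ a c → a := a :+ c :* con 0ℚ) refl a c) (trans (cong (λ y → a + c * y) (sym q₀≡0)) p[c]≡0)
  ∷ IsZero-quotByLinear c (b ∷ p) q≡0 q₀≡0

vanishing⇒IsZero : ∀ L p k → length p ℕ.≤ L → (∀ n → k ℕ.≤ n → eval p (ℕtoℚ n) ≡ 0ℚ) → IsZero p
vanishing⇒IsZero L       []      k _         _        = []
vanishing⇒IsZero (suc L) (a ∷ p) k (s≤s p≤L) vanishes =
  IsZero-quotByLinear c (a ∷ p)
    (vanishing⇒IsZero L (quotByLinear c (a ∷ p)) (suc k)
      (subst (ℕ._≤ L) (sym (length-quotByLinear c a p)) p≤L) quot-vanishes)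
    (vanishes k ℕP.≤-refl)
  where
  c = ℕtoℚ k
  quot-vanishes : ∀ n → suc k ℕ.≤ n → eval (quotByLinear c (a ∷ p)) (ℕtoℚ n) ≡ 0ℚ
  quot-vanishes n k<n = *-cancelʳ-≢0 q[n] 0ℚ (ℕtoℚ n - c) (ℕtoℚ-difference≢0 k<n) (begin
    q[n] * (ℕtoℚ n - c)                       ≡⟨ *-comm q[n] (ℕtoℚ n - c) ⟩
    (ℕtoℚ n - c) * q[n]                       ≡⟨ +-identityˡ _ ⟨
    0ℚ + (ℕtoℚ n - c) * q[n]                  ≡⟨ cong (λ y → y + (ℕtoℚ n - c) * q[n]) (vanishes k ℕP.≤-refl) ⟨
    eval (a ∷ p) c + (ℕtoℚ n - c) * q[n]      ≡⟨ eval-quotByLinear c (a ∷ p) (ℕtoℚ n) ⟨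
    eval (a ∷ p) (ℕtoℚ n)                     ≡⟨ vanishes n (ℕP.<⇒≤ k<n) ⟩
    0ℚ                                        ≡⟨ *-zeroˡ (ℕtoℚ n - c) ⟨
    0ℚ * (ℕtoℚ n - c) ∎)
    where
    open ≡-Reasoning
    q[n] = eval (quotByLinear c (a ∷ p)) (ℕtoℚ n)

lead-unique : ∀ p q → (∀ n → 1 ℕ.≤ n → eval p (ℕtoℚ n) ≡ eval q (ℕtoℚ n)) → lead p ≡ lead q
lead-unique p q agree = lead-cong-IsZero-difference p q
  (vanishing⇒IsZero (length (p +ₚ -ₚ q)) (p +ₚ -ₚ q) 1 ℕP.≤-refl λ n 1≤n →
    trans (eval-+ₚ p (-ₚ q) (ℕtoℚ n))
      (trans (cong (λ y → eval p (ℕtoℚ n) + y) (eval--ₚ q (ℕtoℚ n)))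
        (x≈y⇒x∙y⁻¹≈ε (agree n 1≤n))))

lead-unique-weighted : ∀ (f w : ℕ → ℚ) p q → (∀ n → 1 ℕ.≤ n → w n ≢ 0ℚ) →
  (∀ n → 1 ℕ.≤ n → f n ≡ eval p (ℕtoℚ n) * w n) →
  (∀ n → 1 ℕ.≤ n → f n ≡ eval q (ℕtoℚ n) * w n) → lead p ≡ lead q
lead-unique-weighted f w p q w≢0 f≡pw f≡qw = lead-unique p q λ n 1≤n →
  *-cancelʳ-≢0 _ _ (w n) (w≢0 n 1≤n) (trans (sym (f≡pw n 1≤n)) (f≡qw n 1≤n))

-- The polynomials P_r and Q_r

stepP : Poly → Poly
stepP p = X* ∇ (X* p)

stepQ : Poly → Poly
stepQ q = X* (∇ (X* q) +ₚ X* ∇ q)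

length-stepP : ∀ r p → length p ℕ.≤ suc r → length (stepP p) ℕ.≤ suc (suc r)
length-stepP r p p≤r+1 = length-X* (∇ (X* p)) (length-∇ (suc r) (X* p) (length-X* p p≤r+1))

length-stepQ : ∀ r q → length q ℕ.≤ suc r → length (stepQ q) ℕ.≤ suc (suc r)
length-stepQ r q q≤r+1 = length-X* (∇ (X* q) +ₚ X* ∇ q)
  (length-+ₚ (∇ (X* q)) (X* ∇ q) (length-∇ (suc r) (X* q) (length-X* q q≤r+1))
                                 (length-X* (∇ q) (length-∇ r q q≤r+1)))

coef-∇-X* : ∀ r p → length p ℕ.≤ suc r → coef (∇ (X* p)) r ≡ ℕtoℚ (suc r) * coef p r
coef-∇-X* r p p≤r+1 =
  trans (coef-∇ r (X* p) (length-X* p p≤r+1)) (cong (ℕtoℚ (suc r) *_) (coef-X*-suc p r))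

coef-X*-∇ : ∀ r p → length p ℕ.≤ suc r → coef (X* ∇ p) r ≡ ℕtoℚ r * coef p r
coef-X*-∇ zero    p _     = trans (coef-X*-zero (∇ p)) (sym (*-zeroˡ (coef p 0)))
coef-X*-∇ (suc r) p p≤r+2 = trans (coef-X*-suc (∇ p) r) (coef-∇ r p p≤r+2)

coef-stepP : ∀ r p → length p ℕ.≤ suc r → coef (stepP p) (suc r) ≡ ℕtoℚ (suc r) * coef p r
coef-stepP r p p≤r+1 = trans (coef-X*-suc (∇ (X* p)) r) (coef-∇-X* r p p≤r+1)

coef-stepQ : ∀ r q → length q ℕ.≤ suc r → coef (stepQ q) (suc r) ≡ ℕtoℚ (suc r ℕ.+ r) * coef q r
coef-stepQ r q q≤r+1 = begin
  coef (stepQ q) (suc r)                                ≡⟨ coef-X*-suc (∇ (X* q) +ₚ X* ∇ q) r ⟩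
  coef (∇ (X* q) +ₚ X* ∇ q) r                           ≡⟨ coef-+ₚ (∇ (X* q)) (X* ∇ q) r ⟩
  coef (∇ (X* q)) r + coef (X* ∇ q) r                   ≡⟨ cong₂ _+_ (coef-∇-X* r q q≤r+1) (coef-X*-∇ r q q≤r+1) ⟩
  ℕtoℚ (suc r) * coef q r + ℕtoℚ r * coef q r           ≡⟨ *-distribʳ-+ (coef q r) (ℕtoℚ (suc r)) (ℕtoℚ r) ⟨
  (ℕtoℚ (suc r) + ℕtoℚ r) * coef q r                    ≡⟨ cong (_* coef q r) (ℕtoℚ-+ (suc r) r) ⟨
  ℕtoℚ (suc r ℕ.+ r) * coef q r ∎
  where open ≡-Reasoning

polyP : ℕ → Poly
polyP zero    = 1ℚ ∷ []
polyP (suc r) = stepP (polyP r)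

polyQ : ℕ → Poly
polyQ zero    = 1ℚ ∷ []
polyQ (suc r) = stepQ (polyQ r)

length-polyP : ∀ r → length (polyP r) ℕ.≤ suc r
length-polyP zero    = s≤s z≤n
length-polyP (suc r) = length-stepP r (polyP r) (length-polyP r)

length-polyQ : ∀ r → length (polyQ r) ℕ.≤ suc r
length-polyQ zero    = s≤s z≤n
length-polyQ (suc r) = length-stepQ r (polyQ r) (length-polyQ r)

coef-polyP : ∀ r → coef (polyP r) r ≡ ℕtoℚ (r !)
coef-polyP zero    = refl
coef-polyP (suc r) = begin
  coef (stepP (polyP r)) (suc r)      ≡⟨ coef-stepP r (polyP r) (length-polyP r) ⟩
  ℕtoℚ (suc r) * coef (polyP r) r     ≡⟨ cong (ℕtoℚ (suc r) *_) (coef-polyP r) ⟩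
  ℕtoℚ (suc r) * ℕtoℚ (r !)           ≡⟨ ℕtoℚ-* (suc r) (r !) ⟨
  ℕtoℚ (suc r !) ∎
  where open ≡-Reasoning

coef-polyQ : ∀ r → coef (polyQ r) r ≡ ℕtoℚ (oddProd r)
coef-polyQ zero    = refl
coef-polyQ (suc r) = begin
  coef (stepQ (polyQ r)) (suc r)          ≡⟨ coef-stepQ r (polyQ r) (length-polyQ r) ⟩
  ℕtoℚ (suc r ℕ.+ r) * coef (polyQ r) r   ≡⟨ cong₂ (λ k c → ℕtoℚ k * c) [r+1]+r≡2r+1 (coef-polyQ r) ⟩
  ℕtoℚ (2 ℕ.* r ℕ.+ 1) * ℕtoℚ (oddProd r) ≡⟨ ℕtoℚ-* (2 ℕ.* r ℕ.+ 1) (oddProd r) ⟨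
  ℕtoℚ (oddProd (suc r)) ∎
  where
  open ≡-Reasoning
  [r+1]+r≡2r+1 : suc r ℕ.+ r ≡ 2 ℕ.* r ℕ.+ 1
  [r+1]+r≡2r+1 = trans (cong (λ k → suc (r ℕ.+ k)) (sym (ℕP.+-identityʳ r))) (ℕP.+-comm 1 (2 ℕ.* r))

oddProd≢0 : ∀ r → NonZero (oddProd r)
oddProd≢0 zero    = _
oddProd≢0 (suc r) = ℕP.m*n≢0 (2 ℕ.* r ℕ.+ 1) (oddProd r)
  {{subst NonZero (ℕP.+-comm 1 (2 ℕ.* r)) _}} {{oddProd≢0 r}}

lead-polyP : ∀ r → lead (polyP r) ≡ ℕtoℚ (r !)
lead-polyP r = trans (lead≡coef r (polyP r) (length-polyP r) coef≢0) (coef-polyP r)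
  where coef≢0 = subst (_≢ 0ℚ) (sym (coef-polyP r)) (ℕtoℚ-≢0 (r !) {{ℕP._!≢0 r}})

lead-polyQ : ∀ r → lead (polyQ r) ≡ ℕtoℚ (oddProd r)
lead-polyQ r = trans (lead≡coef r (polyQ r) (length-polyQ r) coef≢0) (coef-polyQ r)
  where coef≢0 = subst (_≢ 0ℚ) (sym (coef-polyQ r)) (ℕtoℚ-≢0 (oddProd r) {{oddProd≢0 r}})

eval-stepP : ∀ p x → eval (stepP p) x ≡ x * (x * eval p x - (x - 1ℚ) * eval p (x - 1ℚ))
eval-stepP p x = begin
  eval (X* ∇ (X* p)) x                                         ≡⟨ eval-X* (∇ (X* p)) x ⟩
  x * eval (∇ (X* p)) x                                        ≡⟨ cong (x *_) (eval-∇ (X* p) x) ⟩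
  x * (eval (X* p) x - eval (X* p) (x - 1ℚ))                   ≡⟨ cong₂ (λ a b → x * (a - b)) (eval-X* p x) (eval-X* p (x - 1ℚ)) ⟩
  x * (x * eval p x - (x - 1ℚ) * eval p (x - 1ℚ)) ∎
  where open ≡-Reasoning

eval-stepQ : ∀ q x → eval (stepQ q) x ≡
  x * ((x * eval q x - (x - 1ℚ) * eval q (x - 1ℚ)) + x * (eval q x - eval q (x - 1ℚ)))
eval-stepQ q x = begin
  eval (X* (∇ (X* q) +ₚ X* ∇ q)) x                             ≡⟨ eval-X* (∇ (X* q) +ₚ X* ∇ q) x ⟩
  x * eval (∇ (X* q) +ₚ X* ∇ q) x                              ≡⟨ cong (x *_) (eval-+ₚ (∇ (X* q)) (X* ∇ q) x) ⟩
  x * (eval (∇ (X* q)) x + eval (X* ∇ q) x)                    ≡⟨ cong₂ (λ a b → x * (a + b)) (eval-∇ (X* q) x)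
                                                                    (trans (eval-X* (∇ q) x) (cong (x *_) (eval-∇ q x))) ⟩
  x * ((eval (X* q) x - eval (X* q) (x - 1ℚ)) + x * (eval q x - eval q (x - 1ℚ)))
                                                               ≡⟨ cong₂ (λ a b → x * ((a - b) + x * (eval q x - eval q (x - 1ℚ))))
                                                                    (eval-X* q x) (eval-X* q (x - 1ℚ)) ⟩
  x * ((x * eval q x - (x - 1ℚ) * eval q (x - 1ℚ)) + x * (eval q x - eval q (x - 1ℚ))) ∎
  where open ≡-Reasoning

eval-stepP-suc : ∀ p n → eval (stepP p) (ℕtoℚ (suc n)) ≡
  ℕtoℚ (suc n) * (ℕtoℚ (suc n) * eval p (ℕtoℚ (suc n)) - ℕtoℚ n * eval p (ℕtoℚ n))
eval-stepP-suc p n = trans (eval-stepP p x)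
  (cong (λ y → x * (x * eval p x - y * eval p y)) (ℕtoℚ-suc-1 n))
  where x = ℕtoℚ (suc n)

eval-stepQ-suc : ∀ q n → eval (stepQ q) (ℕtoℚ (suc n)) ≡
  (1ℚ + ℕtoℚ n) * (((1ℚ + ℕtoℚ n) * eval q (ℕtoℚ (suc n)) - ℕtoℚ n * eval q (ℕtoℚ n))
                   + (1ℚ + ℕtoℚ n) * (eval q (ℕtoℚ (suc n)) - eval q (ℕtoℚ n)))
eval-stepQ-suc q n = trans (eval-stepQ q x)
  (cong₂ (λ u v → u * ((u * eval q x - v * eval q v) + u * (eval q x - eval q v))) (ℕtoℚ-suc n) (ℕtoℚ-suc-1 n))
  where x = ℕtoℚ (suc n)

S[2r+1,n]≡polyP : ∀ r n → ℕtoℚ (S (2 ℕ.* r ℕ.+ 1) n) ≡ eval (polyP r) (ℕtoℚ n) * ℕtoℚ (n ℕ.* ((2 ℕ.* n) C n))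
S[2r+1,n]≡polyP zero    n       = trans (cong ℕtoℚ (S[1,n]≡n*[2n]Cn n))
  (sym (trans (cong (_* ℕtoℚ (n ℕ.* ((2 ℕ.* n) C n))) (eval-constant 1ℚ (ℕtoℚ n))) (*-identityˡ _)))
-- S (suc m) 0 computes to 0.
S[2r+1,n]≡polyP (suc r) zero    = sym (*-zeroʳ (eval (polyP (suc r)) 0ℚ))
S[2r+1,n]≡polyP (suc r) (suc n) = begin
  ℕtoℚ (S (2 ℕ.* suc r ℕ.+ 1) (suc n))
    ≡⟨ cong (λ k → ℕtoℚ (S (k ℕ.+ 1) (suc n))) (ℕP.*-suc 2 r) ⟩
  ℕtoℚ (S (2 ℕ.+ m) (suc n))
    ≡⟨ S-recurrenceℚ m n ⟩
  x * x * ℕtoℚ (S m (suc n)) - K * ℕtoℚ (S m n)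
    ≡⟨ cong₂ (λ u v → x * x * u - K * v) (S[2r+1,n]≡polyP r (suc n)) (S[2r+1,n]≡polyP r n) ⟩
  x * x * (P[x] * ℕtoℚ (suc n ℕ.* A)) - K * (P[x′] * ℕtoℚ (n ℕ.* B))
    ≡⟨ cong₂ (λ u v → x * x * (P[x] * u) - K * (P[x′] * v)) (ℕtoℚ-* (suc n) A) (ℕtoℚ-* n B) ⟩
  x * x * (P[x] * (x * a)) - K * (P[x′] * (x′ * b))
    ≡⟨ solve 7 (λ x x′ P P′ a b K → x :* x :* (P :* (x :* a)) :- K :* (P′ :* (x′ :* b))
                                   := x :* x :* (P :* (x :* a)) :- P′ :* x′ :* (K :* b)) refl x x′ P[x] P[x′] a b K ⟩
  x * x * (P[x] * (x * a)) - P[x′] * x′ * (K * b)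
    ≡⟨ cong (λ y → x * x * (P[x] * (x * a)) - P[x′] * x′ * y) (centralBinomialℚ n) ⟩
  x * x * (P[x] * (x * a)) - P[x′] * x′ * (x * x * a)
    ≡⟨ solve 5 (λ x x′ P P′ a → x :* x :* (P :* (x :* a)) :- P′ :* x′ :* (x :* x :* a)
                               := x :* (x :* P :- x′ :* P′) :* (x :* a)) refl x x′ P[x] P[x′] a ⟩
  x * (x * P[x] - x′ * P[x′]) * (x * a)
    ≡⟨ cong₂ _*_ (sym (eval-stepP-suc (polyP r) n)) (sym (ℕtoℚ-* (suc n) A)) ⟩
  eval (polyP (suc r)) x * ℕtoℚ (suc n ℕ.* A) ∎
  where
  open ≡-Reasoning
  m = 2 ℕ.* r ℕ.+ 1
  x = ℕtoℚ (suc n)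
  x′ = ℕtoℚ n
  P[x] = eval (polyP r) x
  P[x′] = eval (polyP r) x′
  A = (2 ℕ.* suc n) C suc n
  B = (2 ℕ.* n) C n
  a = ℕtoℚ A
  b = ℕtoℚ B
  K = ℕtoℚ (2 ℕ.+ 2 ℕ.* n) * ℕtoℚ (1 ℕ.+ 2 ℕ.* n)

S[2r,n]≡polyQ : ∀ r n → ℕtoℚ (S (2 ℕ.* r) n) ≡ eval (polyQ r) (ℕtoℚ n) * twoPow (+ (2 ℕ.* n) ℤ.- + r)
S[2r,n]≡polyQ zero    n       = begin
  ℕtoℚ (S 0 n)                                    ≡⟨ cong ℕtoℚ (S[0,n]≡2^[2n] n) ⟩
  ℕtoℚ (2 ℕ.^ (2 ℕ.* n))                          ≡⟨ ℕtoℚ-2^ (2 ℕ.* n) ⟩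
  powℚ (ℕtoℚ 2) (2 ℕ.* n)                         ≡⟨ cong (powℚ (ℕtoℚ 2)) (ℕP.+-identityʳ (2 ℕ.* n)) ⟨
  twoPow (+ (2 ℕ.* n) ℤ.- + 0)                    ≡⟨ *-identityˡ _ ⟨
  1ℚ * twoPow (+ (2 ℕ.* n) ℤ.- + 0)               ≡⟨ cong (_* twoPow (+ (2 ℕ.* n) ℤ.- + 0)) (eval-constant 1ℚ (ℕtoℚ n)) ⟨
  eval (polyQ 0) (ℕtoℚ n) * twoPow (+ (2 ℕ.* n) ℤ.- + 0) ∎
  where open ≡-Reasoning
S[2r,n]≡polyQ (suc r) zero    = sym (begin
  eval (X* q) 0ℚ * T     ≡⟨ cong (_* T) (eval-X* q 0ℚ) ⟩
  0ℚ * eval q 0ℚ * T     ≡⟨ cong (_* T) (*-zeroˡ (eval q 0ℚ)) ⟩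
  0ℚ * T                 ≡⟨ *-zeroˡ T ⟩
  0ℚ ∎)
  where
  open ≡-Reasoning
  q = ∇ (X* polyQ r) +ₚ X* ∇ (polyQ r)
  T = twoPow (+ 0 ℤ.- + suc r)
S[2r,n]≡polyQ (suc r) (suc n) = begin
  ℕtoℚ (S (2 ℕ.* suc r) (suc n))
    ≡⟨ cong (λ k → ℕtoℚ (S k (suc n))) (ℕP.*-suc 2 r) ⟩
  ℕtoℚ (S (2 ℕ.+ m) (suc n))
    ≡⟨ S-recurrenceℚ m n ⟩
  x * x * ℕtoℚ (S m (suc n)) - K * ℕtoℚ (S m n)
    ≡⟨ cong₂ (λ u v → x * x * u - K * v) (S[2r,n]≡polyQ r (suc n)) (S[2r,n]≡polyQ r n) ⟩
  x * x * (Q[x] * twoPow (+ (2 ℕ.* suc n) ℤ.- + r)) - K * (Q[x′] * T)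
    ≡⟨ cong₂ (λ u w → u * u * (Q[x] * w) - K * (Q[x′] * T)) (ℕtoℚ-suc n) (twoPow-2[n+1]-r n r) ⟩
  (1ℚ + x′) * (1ℚ + x′) * (Q[x] * (two * (two * T))) - K * (Q[x′] * T)
    ≡⟨ cong (λ k → (1ℚ + x′) * (1ℚ + x′) * (Q[x] * (two * (two * T))) - k * (Q[x′] * T))
            (cong₂ _*_ (ℕtoℚ-a+2n 2 n) (ℕtoℚ-a+2n 1 n)) ⟩
  (1ℚ + x′) * (1ℚ + x′) * (Q[x] * (two * (two * T))) - (two + two * x′) * (ℕtoℚ 1 + two * x′) * (Q[x′] * T)
    ≡⟨ solve 4 (λ x′ Q Q′ T →
         (con 1ℚ :+ x′) :* (con 1ℚ :+ x′) :* (Q :* (con two :* (con two :* T)))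
           :- (con two :+ con two :* x′) :* (con (ℕtoℚ 1) :+ con two :* x′) :* (Q′ :* T)
         := (con 1ℚ :+ x′) :* (((con 1ℚ :+ x′) :* Q :- x′ :* Q′) :+ (con 1ℚ :+ x′) :* (Q :- Q′)) :* (con two :* T))
       refl x′ Q[x] Q[x′] T ⟩
  (1ℚ + x′) * (((1ℚ + x′) * Q[x] - x′ * Q[x′]) + (1ℚ + x′) * (Q[x] - Q[x′])) * (two * T)
    ≡⟨ cong₂ _*_ (sym (eval-stepQ-suc (polyQ r) n)) (sym (twoPow-2[n+1]-[r+1] n r)) ⟩
  eval (polyQ (suc r)) x * twoPow (+ (2 ℕ.* suc n) ℤ.- + suc r) ∎
  where
  open ≡-Reasoning
  m = 2 ℕ.* r
  two = ℕtoℚ 2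
  x = ℕtoℚ (suc n)
  x′ = ℕtoℚ n
  Q[x] = eval (polyQ r) x
  Q[x′] = eval (polyQ r) x′
  T = twoPow (+ (2 ℕ.* n) ℤ.- + r)
  K = ℕtoℚ (2 ℕ.+ 2 ℕ.* n) * ℕtoℚ (1 ℕ.+ 2 ℕ.* n)

mainTheorem3 : (r : ℕ) →
    ((∃ λ P → IsP r P) × (∀ P → IsP r P → lead P ≡ ℕtoℚ (r !)))
    × ((∃ λ Q → IsQ r Q) × (∀ Q → IsQ r Q → lead Q ≡ ℕtoℚ (oddProd r)))
mainTheorem3 r =
  ( (polyP r , λ n _ → S[2r+1,n]≡polyP r n)
  , λ P isP → trans (lead-unique-weighted (λ n → ℕtoℚ (S (2 ℕ.* r ℕ.+ 1) n)) centralWeight P (polyP r)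
                       centralWeight≢0 isP (λ n _ → S[2r+1,n]≡polyP r n))
                    (lead-polyP r) )
  , ( (polyQ r , λ n _ → S[2r,n]≡polyQ r n)
    , λ Q isQ → trans (lead-unique-weighted (λ n → ℕtoℚ (S (2 ℕ.* r) n)) powerWeight Q (polyQ r)
                         (λ n _ → twoPow-≢0 (+ (2 ℕ.* n) ℤ.- + r)) isQ (λ n _ → S[2r,n]≡polyQ r n))
                      (lead-polyQ r) )
  where
  centralWeight powerWeight : ℕ → ℚ
  centralWeight n = ℕtoℚ (n ℕ.* ((2 ℕ.* n) C n))
  powerWeight n = twoPow (+ (2 ℕ.* n) ℤ.- + r)
  centralWeight≢0 : ∀ n → 1 ℕ.≤ n → centralWeight n ≢ 0ℚ
  centralWeight≢0 n 1≤n = ℕtoℚ-≢0 (n ℕ.* ((2 ℕ.* n) C n))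
    {{ℕP.m*n≢0 n ((2 ℕ.* n) C n) {{ℕ.>-nonZero 1≤n}} {{ℕ.>-nonZero (nCk>0 (2 ℕ.* n) n (ℕP.m≤m+n n (n ℕ.+ 0)))}}}}
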